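{- Let $\mathbb{X} = (W, R)$ be an $\mathbf{A}$-Kripke frame. Then $\mathbb{F}_\mathbb{X}^+ \cong(\mathbf{A}^W, [R], \langle R\rangle)$.
   Context: $\mathbf{A}$ is a complete Heyting algebra; an $\mathbf{A}$-Kripke frame is $(W,R)$ with $R:W\times W\to\mathbf{A}$, and $([R]f)(w)=\bigwedge_{v\in W}(R(w,v)\to f(v))$, $(\langle R\rangle f)(w)=\bigvee_{v\in W}(R(w,v)\wedge f(v))$ for $f\in\mathbf{A}^W$. For an $\mathbf{A}$-relation $S:U\times Z\to\mathbf{A}$: $S^{(1)}[f](z)=\bigwedge_{u}(f(u)\to S(u,z))$, $S^{(0)}[g](u)=\bigwedge_{z}(g(z)\to S(u,z))$. $\mathbb{F}_\mathbb{X} = (\mathbb{P}_W, I_R, J_R)$ where $\mathbb{P}_W = (W, \mathbf{A}\times W, I_\Delta)$, $I_\Delta(w,(\alpha,v))=\Delta(w,v)\to\alpha$ ($\Delta(w,v)=\top$ if $w=v$, $\bot$ otherwise), $I_R(w,(\alpha,v))=R(w,v)\to\alpha$, $J_R((\alpha,w),v)=R(w,v)\to\alpha$; $(\cdot)^\uparrow=I_\Delta^{(1)}$, $(\cdot)^\downarrow=I_\Delta^{(0)}$. Its complex algebra is $\mathbb{F}_\mathbb{X}^+=(\mathbb{P}_W^+,[I_R],\langle J_R\rangle)$, with $\mathbb{P}_W^+$ the lattice of formal $\mathbf{A}$-concepts (pairs $(f,u)$ with $f^\uparrow=u$, $u^\downarrow=f$), $[I_R]c=(I_R^{(0)}[(\![c]\!)],(I_R^{(0)}[(\![c]\!)])^\uparrow)$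 and $\langle J_R\rangle c=((J_R^{(0)}[[\![c]\!]])^\downarrow,J_R^{(0)}[[\![c]\!]])$, where $[\![c]\!]$ and $(\![c]\!)$ are the extension and intension of $c$. -}

module Defs where

open import Level using (Level; _⊔_; suc)
open import Data.Product using (_×_; _,_; proj₁; proj₂)
open import Relation.Binary.PropositionalEquality using (_≡_)
open import Relation.Binary.Lattice.Bundles using (HeytingAlgebra)

record CompleteHeytingAlgebra c ℓ₁ ℓ₂ : Set (suc (c ⊔ ℓ₁ ⊔ ℓ₂)) where
  field
    heytingAlgebra : HeytingAlgebra c ℓ₁ ℓ₂
  open HeytingAlgebra heytingAlgebra public
  field
    ⋀ : {I : Set c} → (I → Carrier) → Carrier
    ⋁ : {I : Set c} → (I → Carrier) → Carrier
    ⋀-lower    : {I : Set c} (f : I → Carrier) (i : I) → ⋀ f ≤ f i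
    ⋀-greatest : {I : Set c} (f : I → Carrier) (x : Carrier) →
                 ((i : I) → x ≤ f i) → x ≤ ⋀ f
    ⋁-upper    : {I : Set c} (f : I → Carrier) (i : I) → f i ≤ ⋁ f
    ⋁-least    : {I : Set c} (f : I → Carrier) (x : Carrier) →
                 ((i : I) → f i ≤ x) → ⋁ f ≤ x

module Frame {c ℓ₁ ℓ₂ : Level} (𝐀 : CompleteHeytingAlgebra c ℓ₁ ℓ₂)
             (W : Set c) (R : W → W → CompleteHeytingAlgebra.Carrier 𝐀) where

  open CompleteHeytingAlgebra 𝐀

  A : Set c
  A = Carrier

  _≤ᵂ_ : (W → A) → (W → A) → Set (c ⊔ ℓ₂)
  f ≤ᵂ g = (w : W) → f w ≤ g w

  _≈ᵂ_ : (W → A) → (W → A) → Set (c ⊔ ℓ₁)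
  f ≈ᵂ g = (w : W) → f w ≈ g w

  _≈ᴬᵂ_ : (A × W → A) → (A × W → A) → Set (c ⊔ ℓ₁)
  f ≈ᴬᵂ g = (x : A × W) → f x ≈ g x

  [R] : (W → A) → (W → A)
  [R] f w = ⋀ (λ v → R w v ⇨ f v)

  ⟨R⟩ : (W → A) → (W → A)
  ⟨R⟩ f w = ⋁ (λ v → R w v ∧ f v)

  _⁽¹⁾[_] : {U Z : Set c} → (U → Z → A) → (U → A) → (Z → A)
  (S ⁽¹⁾[ f ]) z = ⋀ (λ u → f u ⇨ S u z)

  _⁽⁰⁾[_] : {U Z : Set c} → (U → Z → A) → (Z → A) → (U → A)
  (S ⁽⁰⁾[ g ]) u = ⋀ (λ z → g z ⇨ S u z)

  -- Δ(w,v) = ⊤ if w = v, ⊥ otherwise (written as a join over proofs of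
  -- w ≡ v, which is ⊤ when w ≡ v and the empty join ⊥ otherwise)
  Δ : W → W → A
  Δ w v = ⋁ {I = w ≡ v} (λ _ → ⊤)

  I-Δ : W → A × W → A
  I-Δ w (α , v) = Δ w v ⇨ α

  I-R : W → A × W → A
  I-R w (α , v) = R w v ⇨ α

  J-R : A × W → W → A
  J-R (α , w) v = R w v ⇨ α

  _↑ : (W → A) → (A × W → A)
  f ↑ = I-Δ ⁽¹⁾[ f ]

  _↓ : (A × W → A) → (W → A)
  u ↓ = I-Δ ⁽⁰⁾[ u ]

  record Concept : Set (c ⊔ ℓ₁) where
    field
      ext    : W → A
      int    : A × W → A
      ext↑   : (ext ↑) ≈ᴬᵂ int
      int↓   : (int ↓) ≈ᵂ ext
  open Concept public

  _⊑_ : Concept → Concept → Set (c ⊔ ℓ₂)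
  c₁ ⊑ c₂ = ext c₁ ≤ᵂ ext c₂

  _≋_ : Concept → Concept → Set (c ⊔ ℓ₁)
  c₁ ≋ c₂ = (ext c₁ ≈ᵂ ext c₂) × (int c₁ ≈ᴬᵂ int c₂)

  [I-R]-ext : Concept → (W → A)
  [I-R]-ext c = I-R ⁽⁰⁾[ int c ]

  [I-R]-int : Concept → (A × W → A)
  [I-R]-int c = ([I-R]-ext c) ↑

  ⟨J-R⟩-int : Concept → (A × W → A)
  ⟨J-R⟩-int c = J-R ⁽⁰⁾[ ext c ]

  ⟨J-R⟩-ext : Concept → (W → A)
  ⟨J-R⟩-ext c = (⟨J-R⟩-int c) ↓

  _is⟨_,_⟩ : Concept → (W → A) → (A × W → A) → Set (c ⊔ ℓ₁)
  d is⟨ f , u ⟩ = (ext d ≈ᵂ f) × (int d ≈ᴬᵂ u)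

  -- F_X^+ ≅ (A^W, [R], ⟨R⟩): an order isomorphism between the concept
  -- lattice and A^W (hence a complete lattice isomorphism) which
  -- intertwines [I_R] with [R] and ⟨J_R⟩ with ⟨R⟩.
  record ComplexAlgebraIso : Set (c ⊔ ℓ₁ ⊔ ℓ₂) where
    field
      φ : Concept → (W → A)
      ψ : (W → A) → Concept
      ψφ : (d : Concept) → ψ (φ d) ≋ d
      φψ : (f : W → A) → φ (ψ f) ≈ᵂ f
      φ-mono    : (d₁ d₂ : Concept) → d₁ ⊑ d₂ → φ d₁ ≤ᵂ φ d₂
      φ-reflect : (d₁ d₂ : Concept) → φ d₁ ≤ᵂ φ d₂ → d₁ ⊑ d₂
      box : (d : Concept) → ψ ([R] (φ d)) is⟨ [I-R]-ext d , [I-R]-int d ⟩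
      dia : (d : Concept) → ψ (⟨R⟩ (φ d)) is⟨ ⟨J-R⟩-ext d , ⟨J-R⟩-int d ⟩

-- Every A-valued subset f of W is the extension of exactly one formal concept,
-- namely (f , f↑), because f↑(α , v) = f v ⇨ α and hence f↑↓ = f: the concept
-- lattice of P_W is just A^W. Under this identification both operators reduce
-- to Heyting-algebra identities: [I_R] computes ⋀_{α,v} ((f v ⇨ α) ⇨ (R w v ⇨ α)),
-- which is ⋀_v (R w v ⇨ f v) by a Yoneda-style argument (instantiate α := f v),
-- and ⟨J_R⟩ computes ⋀_u (f u ⇨ R v u ⇨ α) = (⋁_u (R v u ∧ f u)) ⇨ α = (⟨R⟩ f)↑.

module Submission where

open import Defs
open import Level using (Level)
open import Data.Product using (_×_; _,_)
import Relation.Binary.PropositionalEquality as ≡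
import Relation.Binary.Lattice.Properties.HeytingAlgebra as HeytingAlgebraProperties
import Relation.Binary.Lattice.Properties.MeetSemilattice as MeetSemilatticeProperties
import Relation.Binary.Reasoning.Setoid as ≈-Reasoning

module CompleteHeytingAlgebraProperties
    {c ℓ₁ ℓ₂ : Level} (𝐀 : CompleteHeytingAlgebra c ℓ₁ ℓ₂) where

  open CompleteHeytingAlgebra 𝐀
  open HeytingAlgebraProperties heytingAlgebra
  open MeetSemilatticeProperties meetSemilattice using (∧-comm; ∧-monotonic)

  ⋀-mono : {I : Set c} {f g : I → Carrier} →
           ((i : I) → f i ≤ g i) → ⋀ f ≤ ⋀ g
  ⋀-mono {g = g} f≤g = ⋀-greatest g _ (λ i → trans (⋀-lower _ i) (f≤g i))

  ⋀-cong : {I : Set c} {f g : I → Carrier} →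
           ((i : I) → f i ≈ g i) → ⋀ f ≈ ⋀ g
  ⋀-cong f≈g = antisym (⋀-mono (λ i → reflexive (f≈g i)))
                       (⋀-mono (λ i → reflexive (Eq.sym (f≈g i))))

  ⊤≤x⇒x⇨y≤y : ∀ {x y} → ⊤ ≤ x → x ⇨ y ≤ y
  ⊤≤x⇒x⇨y≤y ⊤≤x = trans (∧-greatest refl (trans (maximum _) ⊤≤x)) ⇨-eval

  ⇨-flip : ∀ {x y z} → x ⇨ y ⇨ z ≈ y ⇨ x ⇨ z
  ⇨-flip = Eq.trans (Eq.sym ⇨-curry) (Eq.trans (⇨-cong (∧-comm _ _) Eq.refl) ⇨-curry)

  ⇨-compose : ∀ {x y z} → x ⇨ y ≤ (y ⇨ z) ⇨ x ⇨ z
  ⇨-compose = transpose-⇨ (transpose-⇨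
    (trans (∧-greatest (trans (x∧y≤x _ _) (x∧y≤y _ _))
                       (trans (∧-monotonic (x∧y≤x _ _) refl) ⇨-eval))
           ⇨-eval))

  ⋁-⇨ : {I : Set c} (f : I → Carrier) (x : Carrier) →
        ⋁ f ⇨ x ≈ ⋀ (λ i → f i ⇨ x)
  ⋁-⇨ f x = antisym
    (⋀-greatest _ _ (λ i → ⇨ˡ-contravariant (⋁-upper f i)))
    (swap-transpose-⇨ (transpose-∧ (⋁-least f _ (λ i →
      swap-transpose-⇨ (trans (∧-monotonic (⋀-lower _ i) refl) ⇨-eval)))))

  ⋀-yoneda : {J : Set c} (a b : J → Carrier) →
             ⋀ (λ ((x , j) : Carrier × J) → (a j ⇨ x) ⇨ b j ⇨ x) ≈ ⋀ (λ j → b j ⇨ a j)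
  ⋀-yoneda a b = antisym
    (⋀-greatest _ _ (λ j → trans (⋀-lower _ (a j , j))
                                 (⊤≤x⇒x⇨y≤y (reflexive (Eq.sym ⇨-unit)))))
    (⋀-greatest _ _ (λ (x , j) → trans (⋀-lower _ j) ⇨-compose))

module ConceptLattice
    {c ℓ₁ ℓ₂ : Level} (𝐀 : CompleteHeytingAlgebra c ℓ₁ ℓ₂)
    (W : Set c) (R : W → W → CompleteHeytingAlgebra.Carrier 𝐀) where

  open CompleteHeytingAlgebra 𝐀
  open HeytingAlgebraProperties heytingAlgebra
  open MeetSemilatticeProperties meetSemilattice using (∧-comm)
  open CompleteHeytingAlgebraProperties 𝐀
  open Frame 𝐀 W R

  ⁽¹⁾-cong : {U Z : Set c} (S : U → Z → A) {f g : U → A} →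
             ((u : U) → f u ≈ g u) → (z : Z) → (S ⁽¹⁾[ f ]) z ≈ (S ⁽¹⁾[ g ]) z
  ⁽¹⁾-cong S f≈g z = ⋀-cong (λ u → ⇨-cong (f≈g u) Eq.refl)

  ⁽⁰⁾-cong : {U Z : Set c} (S : U → Z → A) {f g : Z → A} →
             ((z : Z) → f z ≈ g z) → (u : U) → (S ⁽⁰⁾[ f ]) u ≈ (S ⁽⁰⁾[ g ]) u
  ⁽⁰⁾-cong S f≈g u = ⋀-cong (λ z → ⇨-cong (f≈g z) Eq.refl)

  Δ⇨-intro : ∀ {u v x y} → (u ≡.≡ v → x ≤ y) → x ≤ Δ u v ⇨ y
  Δ⇨-intro u≡v⇒x≤y = swap-transpose-⇨ (transpose-∧ (⋁-least _ _ (λ u≡v →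
    transpose-⇨ (trans (x∧y≤y _ _) (u≡v⇒x≤y u≡v)))))

  ⊤≤Δ-refl : ∀ {w} → ⊤ ≤ Δ w w
  ⊤≤Δ-refl = ⋁-upper _ ≡.refl

  ⋀-Δ⇨ˡ : (g : W → A) (w : W) → ⋀ (λ v → Δ w v ⇨ g v) ≈ g w
  ⋀-Δ⇨ˡ g w = antisym (trans (⋀-lower _ w) (⊤≤x⇒x⇨y≤y ⊤≤Δ-refl))
                      (⋀-greatest _ _ (λ v → Δ⇨-intro (λ { ≡.refl → refl })))

  ⋀-Δ⇨ʳ : (g : W → A) (v : W) → ⋀ (λ u → Δ u v ⇨ g u) ≈ g v
  ⋀-Δ⇨ʳ g v = antisym (trans (⋀-lower _ v) (⊤≤x⇒x⇨y≤y ⊤≤Δ-refl))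
                      (⋀-greatest _ _ (λ u → Δ⇨-intro (λ { ≡.refl → refl })))

  ↑-pointwise : (f : W → A) (α : A) (v : W) → (f ↑) (α , v) ≈ (f v ⇨ α)
  ↑-pointwise f α v = Eq.trans (⋀-cong (λ u → ⇨-flip)) (⋀-Δ⇨ʳ (λ u → f u ⇨ α) v)

  -- I⟨ Δ ⟩ and I⟨ R ⟩ are I-Δ and I-R up to η for pairs.
  I⟨_⟩ : (W → W → A) → W → A × W → A
  I⟨ S ⟩ w (α , v) = S w v ⇨ α

  ⁽⁰⁾-↑ : (S : W → W → A) (f : W → A) (w : W) →
          (I⟨ S ⟩ ⁽⁰⁾[ f ↑ ]) w ≈ ⋀ (λ v → S w v ⇨ f v)
  ⁽⁰⁾-↑ S f w = Eq.trans (⁽⁰⁾-cong I⟨ S ⟩ (λ (α , v) → ↑-pointwise f α v) w)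
                         (⋀-yoneda f (S w))

  ↑↓-id : (f : W → A) → ((f ↑) ↓) ≈ᵂ f
  ↑↓-id f w = Eq.trans (⁽⁰⁾-↑ Δ f w) (⋀-Δ⇨ˡ f w)

  ⟨R⟩-↑ : (f : W → A) → (⟨R⟩ f ↑) ≈ᴬᵂ (J-R ⁽⁰⁾[ f ])
  ⟨R⟩-↑ f (α , v) = begin
    (⟨R⟩ f ↑) (α , v)                 ≈⟨ ↑-pointwise (⟨R⟩ f) α v ⟩
    ⋁ (λ u → R v u ∧ f u) ⇨ α         ≈⟨ ⋁-⇨ _ α ⟩
    ⋀ (λ u → R v u ∧ f u ⇨ α)         ≈⟨ ⋀-cong (λ u → ⇨-cong (∧-comm _ _) Eq.refl) ⟩
    ⋀ (λ u → f u ∧ R v u ⇨ α)         ≈⟨ ⋀-cong (λ u → ⇨-curry) ⟩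
    (J-R ⁽⁰⁾[ f ]) (α , v)            ∎
    where open ≈-Reasoning setoid

  concept : (W → A) → Concept
  concept f = record
    { ext = f ; int = f ↑ ; ext↑ = λ _ → Eq.refl ; int↓ = ↑↓-id f }

  [R]≈[I-R]-ext : (d : Concept) → [R] (ext d) ≈ᵂ [I-R]-ext d
  [R]≈[I-R]-ext d w = Eq.sym (Eq.trans (⁽⁰⁾-cong I-R (λ z → Eq.sym (ext↑ d z)) w)
                                       (⁽⁰⁾-↑ R (ext d) w))

  ⟨R⟩≈⟨J-R⟩-ext : (d : Concept) → ⟨R⟩ (ext d) ≈ᵂ ⟨J-R⟩-ext d
  ⟨R⟩≈⟨J-R⟩-ext d w = Eq.trans (Eq.sym (↑↓-id (⟨R⟩ (ext d)) w))
                               (⁽⁰⁾-cong I-Δ (⟨R⟩-↑ (ext d)) w)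

  complexAlgebraIso : ComplexAlgebraIso
  complexAlgebraIso = record
    { φ         = ext
    ; ψ         = concept
    ; ψφ        = λ d → (λ _ → Eq.refl) , ext↑ d
    ; φψ        = λ f _ → Eq.refl
    ; φ-mono    = λ _ _ d₁⊑d₂ → d₁⊑d₂
    ; φ-reflect = λ _ _ d₁⊑d₂ → d₁⊑d₂
    ; box       = λ d → [R]≈[I-R]-ext d , ⁽¹⁾-cong I-Δ ([R]≈[I-R]-ext d)
    ; dia       = λ d → ⟨R⟩≈⟨J-R⟩-ext d , ⟨R⟩-↑ (ext d)
    }

lemma5p7 : {c ℓ₁ ℓ₂ : Level} (𝐀 : CompleteHeytingAlgebra c ℓ₁ ℓ₂)
           (W : Set c) (R : W → W → CompleteHeytingAlgebra.Carrier 𝐀) →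
           Frame.ComplexAlgebraIso 𝐀 W R
lemma5p7 𝐀 W R = ConceptLattice.complexAlgebraIso 𝐀 W R
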